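{- Let $n$ be a positive integer such that $n-1$ is square-free (divisible by no square other than $1$). Then there is no non-trivial $(n,m,k,\lambda)$-SEDF in any group of order $n$; that is, every $(n,m,k,\lambda)$-SEDF in a group of order $n$ has $k=1$ (and then $\lambda=1$, $m=n$).
   Context: Let $G$ be a finite group of order $n$ (written multiplicatively). An $(n,m,k,\lambda)$-SEDF in $G$ is a set of $m\ge2$ pairwise disjoint $k$-subsets $A_1,\ldots,A_m$ of $G$ such that for every $i$ the multiset $\{xy^{ -1}: x\in A_i, y\in \bigcup_{j\neq i}A_j\}$ contains every non-identity element of $G$ exactly $\lambda$ times. An SEDF is called trivial if $k=1$, and non-trivial if $k>1$. -}

module Defs where

open import Data.Nat using (ℕ; _*_; _∸_; _≤_)
open import Data.Nat.Divisibility using (_∣_)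
open import Data.Fin using (Fin; _≟_)
open import Data.Fin.Properties using (any?)
open import Data.Fin.Subset using (Subset; _∈_; _∉_; ∣_∣)
open import Data.Fin.Subset.Properties using (_∈?_)
open import Data.List using (List; length; filter; cartesianProduct)
open import Data.Product using (Σ; _×_; _,_; proj₁; proj₂)
open import Relation.Nullary using (¬_; Dec)
open import Relation.Nullary.Decidable using (_×-dec_; ¬?)
open import Relation.Binary.PropositionalEquality using (_≡_; _≢_)
open import Algebra.Structures using (IsGroup)
open import Data.List using (allFin)

-- A finite group of order n, represented (up to isomorphism) as a group
-- structure on the carrier Fin n with propositional equality.
record FinGroup (n : ℕ) : Set where
  field
    _∙_     : Fin n → Fin n → Fin n
    ε       : Fin n
    _⁻¹     : Fin n → Fin n
    isGroup : IsGroup _≡_ _∙_ ε _⁻¹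

allElems : (n : ℕ) → List (Fin n)
allElems n = allFin n

InOthers : ∀ {n m} → (Fin m → Subset n) → Fin m → Fin n → Set
InOthers {m = m} A i y = Σ (Fin m) (λ j → j ≢ i × y ∈ A j)

inOthers? : ∀ {n m} (A : Fin m → Subset n) (i : Fin m) (y : Fin n) →
            Dec (InOthers A i y)
inOthers? A i y = any? (λ j → ¬? (j ≟ i) ×-dec (y ∈? A j))

-- multiplicity of g in the multiset { x y⁻¹ : x ∈ A i, y ∈ ⋃_{j≠i} A j }
diffCount : ∀ {n m} → FinGroup n → (Fin m → Subset n) → Fin m → Fin n → ℕ
diffCount {n} G A i g =
  length (filter (λ p → (proj₁ p ∈? A i) ×-dec
                        (inOthers? A i (proj₂ p) ×-dec
                         ((proj₁ p ∙ (proj₂ p ⁻¹)) ≟ g)))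
                 (cartesianProduct (allElems n) (allElems n)))
  where open FinGroup G

record IsSEDF {n : ℕ} (G : FinGroup n) (m k lam : ℕ) (A : Fin m → Subset n) : Set where
  open FinGroup G
  field
    two≤m    : 2 ≤ m
    disjoint : ∀ i j → i ≢ j → ∀ x → x ∈ A i → x ∉ A j
    size     : ∀ i → ∣ A i ∣ ≡ k
    external : ∀ i (g : Fin n) → g ≢ ε → diffCount G A i g ≡ lam

SquareFree : ℕ → Set
SquareFree a = ∀ d → d * d ∣ a → d ≡ 1

-- Write n = N + 1 and m = M + 1. Summing the defining multiplicities over all g counts every pair
-- (x, y) with x ∈ Aᵢ and y in another block exactly once, while g = ε contributes nothing since the
-- blocks are disjoint; hence N λ = k · M k. As N is square-free and divides k² M, it divides k M,
-- so N ≤ k M. The blocks are disjoint, so (M + 1) k ≤ N + 1 ≤ k M + 1, which forces k = 1, and then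
-- N λ = M ≤ N gives λ = 1 and M = N.
module Submission where

open import Defs
open import Data.Nat
  using (ℕ; zero; suc; _+_; _*_; _∸_; _≤_; z≤n; s≤s; s≤s⁻¹; NonZero; ≢-nonZero; ≢-nonZero⁻¹; >-nonZero)
open import Data.Nat.Properties
  using (+-*-semiring; +-identityʳ; *-identityʳ; *-zeroʳ; *-comm; *-assoc; +-mono-≤; +-cancelʳ-≤;
         *-cancelˡ-≡; m*n≢0; m≤m*n; ≤-antisym; ≤-trans; ≤-reflexive; module ≤-Reasoning)
open import Data.Nat.Divisibility using (_∣_; divides; ∣⇒≤; *-pres-∣; ∣-trans)
open import Data.Nat.GCD using (gcd; gcd[m,n]∣m; gcd[m,n]∣n; gcd-greatest)
open import Data.Nat.Coprimality using (Coprime; coprime-divisor)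
open import Data.Bool using (true; false; if_then_else_)
open import Data.Fin using (Fin; zero; suc; _≟_; punchIn)
open import Data.Fin.Properties using (any?; punchInᵢ≢i; suc-injective)
open import Data.Fin.Subset using (Subset; _∈_; ∣_∣; inside; outside)
open import Data.Fin.Subset.Properties using (_∈?_)
open import Data.List using (length; filter; map; tabulate; _++_; cartesianProduct)
open import Data.List.Properties using (length-++; filter-++; map-tabulate; filter-none)
open import Data.List.Relation.Unary.All using (universal)
open import Data.Vec using ([]; _∷_)
open import Data.Product using (_×_; _,_; proj₁; proj₂)
open import Data.Empty using (⊥-elim)
open import Function using (id; _∘_; case_of_)
open import Relation.Nullary using (¬_; Dec; yes; no; does)
open import Relation.Nullary.Decidable using (_×-dec_; _⊎-dec_; ¬?; decidable-stable)
open import Relation.Unary using (Pred; Decidable)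
open import Relation.Binary.PropositionalEquality
open import Algebra.Bundles using (Group)
open import Level using (0ℓ)
open import Algebra.Properties.Semiring.Sum +-*-semiring
  using (sum; sum-syntax; ∑-comm; *-distribˡ-sum; *-distribʳ-sum; sum-cong-≗; sum-remove)
import Algebra.Properties.Group as GroupProperties

𝟙 : ∀ {p} {P : Set p} → Dec P → ℕ
𝟙 d = if does d then 1 else 0

𝟙≤1 : ∀ {p} {P : Set p} (d : Dec P) → 𝟙 d ≤ 1
𝟙≤1 (yes _) = s≤s z≤n
𝟙≤1 (no _)  = z≤n

𝟙-×-dec : ∀ {p q} {P : Set p} {Q : Set q} (a : Dec P) (b : Dec Q) → 𝟙 (a ×-dec b) ≡ 𝟙 a * 𝟙 b
𝟙-×-dec (yes _) b = sym (+-identityʳ (𝟙 b))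
𝟙-×-dec (no _)  b = refl

𝟙-⊎-dec : ∀ {p q} {P : Set p} {Q : Set q} (a : Dec P) (b : Dec Q) →
          ¬ (P × Q) → 𝟙 (a ⊎-dec b) ≡ 𝟙 a + 𝟙 b
𝟙-⊎-dec (yes p) (yes q) ¬pq = ⊥-elim (¬pq (p , q))
𝟙-⊎-dec (yes _) (no _)  _   = refl
𝟙-⊎-dec (no _)  b       _   = refl

∑-const : ∀ n c → ∑[ i < n ] c ≡ n * c
∑-const zero    c = refl
∑-const (suc n) c = cong (c +_) (∑-const n c)

∑-product : ∀ {a b} (f : Fin a → ℕ) (g : Fin b → ℕ) →
            ∑[ x < a ] (∑[ y < b ] (f x * g y)) ≡ sum f * sum g
∑-product f g = begin
  ∑[ x < _ ] (∑[ y < _ ] (f x * g y))  ≡⟨ sum-cong-≗ (λ x → *-distribˡ-sum (f x) g) ⟨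
  ∑[ x < _ ] (f x * sum g)             ≡⟨ *-distribʳ-sum (sum g) f ⟨
  sum f * sum g                        ∎
  where open ≡-Reasoning

∑-𝟙-≤ : ∀ {n p} {P : Pred (Fin n) p} (P? : Decidable P) → ∑[ x < n ] 𝟙 (P? x) ≤ n
∑-𝟙-≤ {zero}  P? = z≤n
∑-𝟙-≤ {suc n} P? = +-mono-≤ (𝟙≤1 (P? zero)) (∑-𝟙-≤ (P? ∘ suc))

∑-𝟙-≟ : ∀ {n} (c : Fin n) → ∑[ g < n ] 𝟙 (c ≟ g) ≡ 1
∑-𝟙-≟ {suc n} zero    = cong suc (trans (∑-const n 0) (*-zeroʳ n))
∑-𝟙-≟ {suc n} (suc c) = ∑-𝟙-≟ c

∑-𝟙-∈ : ∀ {n} (p : Subset n) → ∑[ x < n ] 𝟙 (x ∈? p) ≡ ∣ p ∣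
∑-𝟙-∈ []            = refl
∑-𝟙-∈ (inside  ∷ p) = cong suc (∑-𝟙-∈ p)
∑-𝟙-∈ (outside ∷ p) = ∑-𝟙-∈ p

𝟙-any? : ∀ {n p} {P : Pred (Fin n) p} (P? : Decidable P) →
         (∀ {i j} → P i → P j → i ≡ j) → 𝟙 (any? P?) ≡ ∑[ i < n ] 𝟙 (P? i)
𝟙-any? {zero}  P? unique = refl
𝟙-any? {suc n} P? unique = trans
  (𝟙-⊎-dec (P? zero) (any? (P? ∘ suc)) λ { (p₀ , (_ , p₁₊ᵢ)) → case unique p₀ p₁₊ᵢ of λ () })
  (cong (𝟙 (P? zero) +_) (𝟙-any? (P? ∘ suc) (λ p q → suc-injective (unique p q))))

disjoint-∑∣∣≤ : ∀ {m n} (A : Fin m → Subset n) → (∀ {x i j} → x ∈ A i → x ∈ A j → i ≡ j) →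
                ∑[ j < m ] ∣ A j ∣ ≤ n
disjoint-∑∣∣≤ {m} {n} A unique = begin
  ∑[ j < m ] ∣ A j ∣                      ≡⟨ sum-cong-≗ (λ j → ∑-𝟙-∈ (A j)) ⟨
  ∑[ j < m ] (∑[ y < n ] 𝟙 (y ∈? A j))    ≡⟨ ∑-comm (λ j y → 𝟙 (y ∈? A j)) ⟩
  ∑[ y < n ] (∑[ j < m ] 𝟙 (y ∈? A j))    ≡⟨ sum-cong-≗ (λ y → 𝟙-any? (λ j → y ∈? A j) unique) ⟨
  ∑[ y < n ] 𝟙 (any? (λ j → y ∈? A j))    ≤⟨ ∑-𝟙-≤ (λ y → any? (λ j → y ∈? A j)) ⟩
  n                                       ∎
  where open ≤-Reasoning

∑-except : ∀ {n} (f : Fin (suc n) → ℕ) (i : Fin (suc n)) {c} →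
           f i ≡ 0 → (∀ j → j ≢ i → f j ≡ c) → ∑[ j < suc n ] f j ≡ n * c
∑-except {n} f i {c} fᵢ≡0 fⱼ≡c = begin
  sum f                              ≡⟨ sum-remove {i = i} f ⟩
  f i + ∑[ j < n ] f (punchIn i j)   ≡⟨ cong₂ _+_ fᵢ≡0 (sum-cong-≗ λ j → fⱼ≡c _ (punchInᵢ≢i i j)) ⟩
  ∑[ j < n ] c                       ≡⟨ ∑-const n c ⟩
  n * c                              ∎
  where open ≡-Reasoning

length-filter-tabulate : ∀ {a n p} {A : Set a} {P : Pred A p} (P? : Decidable P) (f : Fin n → A) →
                         length (filter P? (tabulate f)) ≡ ∑[ i < n ] 𝟙 (P? (f i))
length-filter-tabulate {n = zero}  P? f = refl
length-filter-tabulate {n = suc n} P? f with does (P? (f zero))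
... | true  = cong suc (length-filter-tabulate P? (f ∘ suc))
... | false = length-filter-tabulate P? (f ∘ suc)

length-filter-cartesianProduct :
  ∀ {a b p m n} {A : Set a} {B : Set b} {P : Pred (A × B) p} (P? : Decidable P)
  (f : Fin m → A) (g : Fin n → B) →
  length (filter P? (cartesianProduct (tabulate f) (tabulate g))) ≡
  ∑[ i < m ] (∑[ j < n ] 𝟙 (P? (f i , g j)))
length-filter-cartesianProduct {m = zero}  P? f g = refl
length-filter-cartesianProduct {m = suc m} P? f g = begin
  length (filter P? (row ++ rest))                   ≡⟨ cong length (filter-++ P? row rest) ⟩
  length (filter P? row ++ filter P? rest)           ≡⟨ length-++ (filter P? row) ⟩
  length (filter P? row) + length (filter P? rest)   ≡⟨ cong₂ _+_ row-count rest-count ⟩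
  ∑[ i < suc m ] (∑[ j < _ ] 𝟙 (P? (f i , g j)))      ∎
  where
  open ≡-Reasoning
  row  = map (f zero ,_) (tabulate g)
  rest = cartesianProduct (tabulate (f ∘ suc)) (tabulate g)
  row-count = trans (cong (length ∘ filter P?) (map-tabulate g (f zero ,_)))
                    (length-filter-tabulate P? ((f zero ,_) ∘ g))
  rest-count = length-filter-cartesianProduct P? (f ∘ suc) g

squareFree⇒∣a*a*b⇒∣a*b : ∀ {n a b} → SquareFree n → n ∣ a * a * b → n ∣ a * b
squareFree⇒∣a*a*b⇒∣a*b {n} {a} {b} squareFree n∣aab = n∣ab
  where
  q = _∣_.quotient (gcd[m,n]∣m n a)
  n≡q*g : n ≡ q * gcd n a
  n≡q*g = _∣_.equality (gcd[m,n]∣m n a)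
  q∣n : q ∣ n
  q∣n = divides (gcd n a) (trans n≡q*g (*-comm q (gcd n a)))
  q⊥a : Coprime q a
  q⊥a {d} (d∣q , d∣a) =
    squareFree d (subst (d * d ∣_) (sym n≡q*g) (*-pres-∣ d∣q (gcd-greatest (∣-trans d∣q q∣n) d∣a)))
  q∣b : q ∣ b
  q∣b = coprime-divisor q⊥a (coprime-divisor q⊥a (subst (q ∣_) (*-assoc a a b) (∣-trans q∣n n∣aab)))
  n∣ab : n ∣ a * b
  n∣ab = subst₂ _∣_ (sym n≡q*g) (*-comm b a) (*-pres-∣ q∣b (gcd[m,n]∣n n a))

module _ {N M : ℕ} (1≤M : 1 ≤ M) where

  private
    instance
      M≢0 : NonZero M
      M≢0 = >-nonZero 1≤M

  k≤1 : ∀ {k lam} → SquareFree N → 1 ≤ k →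
        N * lam ≡ k * (M * k) → suc M * k ≤ suc N → k ≤ 1
  k≤1 {k} {lam} squareFree 1≤k counting packing = +-cancelʳ-≤ (M * k) k 1 (begin
    suc M * k      ≤⟨ packing ⟩
    suc N          ≤⟨ s≤s N≤k*M ⟩
    suc (k * M)    ≡⟨ cong suc (*-comm k M) ⟩
    1 + M * k      ∎)
    where
    open ≤-Reasoning
    instance
      k≢0 : NonZero k
      k≢0 = >-nonZero 1≤k
    kkM≡lam*N : k * k * M ≡ lam * N
    kkM≡lam*N = begin-equality
      k * k * M      ≡⟨ *-assoc k k M ⟩
      k * (k * M)    ≡⟨ cong (k *_) (*-comm k M) ⟩
      k * (M * k)    ≡⟨ counting ⟨
      N * lam        ≡⟨ *-comm N lam ⟩
      lam * N        ∎
    N≤k*M : N ≤ k * M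
    N≤k*M = ∣⇒≤ {{m*n≢0 k M}} (squareFree⇒∣a*a*b⇒∣a*b {a = k} squareFree (divides lam kkM≡lam*N))

  k≡1⇒lam≡1×M≡N : ∀ {lam} → N * lam ≡ 1 * (M * 1) → suc M * 1 ≤ suc N → lam ≡ 1 × M ≡ N
  k≡1⇒lam≡1×M≡N {lam} counting packing = lam≡1 , M≡N
    where
    N*lam≡M : N * lam ≡ M
    N*lam≡M = trans counting (trans (+-identityʳ (M * 1)) (*-identityʳ M))
    instance
      lam≢0 : NonZero lam
      lam≢0 = ≢-nonZero λ { refl → ≢-nonZero⁻¹ M (trans (sym N*lam≡M) (*-zeroʳ N)) }
    M≡N : M ≡ N
    M≡N = ≤-antisym (s≤s⁻¹ (subst (_≤ suc N) (*-identityʳ (suc M)) packing))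
                    (subst (N ≤_) N*lam≡M (m≤m*n N lam))
    lam≡1 : lam ≡ 1
    lam≡1 = *-cancelˡ-≡ lam 1 N {{>-nonZero (≤-trans 1≤M (≤-reflexive M≡N))}}
              (trans N*lam≡M (trans M≡N (sym (*-identityʳ N))))

  sedf-parameters : ∀ {k lam} → SquareFree N → 1 ≤ k →
                    N * lam ≡ k * (M * k) → suc M * k ≤ suc N → k ≡ 1 × lam ≡ 1 × M ≡ N
  sedf-parameters squareFree 1≤k counting packing
    with refl ← ≤-antisym (k≤1 squareFree 1≤k counting packing) 1≤k
    = refl , k≡1⇒lam≡1×M≡N counting packing

module _ {N M k lam : ℕ} {G : FinGroup (suc N)} {A : Fin (suc M) → Subset (suc N)}
         (sedf : IsSEDF G (suc M) k lam A) where

  open FinGroup G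
  open IsSEDF sedf

  group : Group 0ℓ 0ℓ
  group = record { isGroup = isGroup }

  open GroupProperties group using (x∙y⁻¹≈ε⇒x≈y)

  ∈-unique : ∀ {x i j} → x ∈ A i → x ∈ A j → i ≡ j
  ∈-unique {x} {i} {j} x∈Aᵢ x∈Aⱼ =
    decidable-stable (i ≟ j) λ i≢j → disjoint i j i≢j x x∈Aᵢ x∈Aⱼ

  packing-bound : suc M * k ≤ suc N
  packing-bound =
    subst (_≤ suc N) (trans (sum-cong-≗ size) (∑-const (suc M) k)) (disjoint-∑∣∣≤ A ∈-unique)

  difference? : ∀ i g → Decidable (λ (p : Fin (suc N) × Fin (suc N)) →
                  proj₁ p ∈ A i × InOthers A i (proj₂ p) × proj₁ p ∙ (proj₂ p ⁻¹) ≡ g)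
  difference? i g p = proj₁ p ∈? A i ×-dec (inOthers? A i (proj₂ p) ×-dec (proj₁ p ∙ (proj₂ p ⁻¹)) ≟ g)

  diffCount-ε : ∀ i → diffCount G A i ε ≡ 0
  diffCount-ε i = cong length (filter-none (difference? i ε) (universal no-difference pairs))
    where
    pairs = cartesianProduct (allElems (suc N)) (allElems (suc N))
    no-difference : ∀ p → ¬ (proj₁ p ∈ A i × InOthers A i (proj₂ p) × proj₁ p ∙ (proj₂ p ⁻¹) ≡ ε)
    no-difference (x , y) (x∈Aᵢ , (j , j≢i , y∈Aⱼ) , x∙y⁻¹≡ε) =
      j≢i (∈-unique y∈Aⱼ (subst (_∈ A i) (x∙y⁻¹≈ε⇒x≈y x y x∙y⁻¹≡ε) x∈Aᵢ))

  diffCount≡∑ : ∀ i g → diffCount G A i g ≡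
                ∑[ x < suc N ] (∑[ y < suc N ] (𝟙 (x ∈? A i) * 𝟙 (inOthers? A i y) * 𝟙 (x ∙ (y ⁻¹) ≟ g)))
  diffCount≡∑ i g = trans (length-filter-cartesianProduct (difference? i g) id id)
    (sum-cong-≗ λ x → sum-cong-≗ λ y → 𝟙-×-dec³ (x ∈? A i) (inOthers? A i y) ((x ∙ (y ⁻¹)) ≟ g))
    where
    𝟙-×-dec³ : ∀ {a b c} {P : Set a} {Q : Set b} {R : Set c} (p : Dec P) (q : Dec Q) (r : Dec R) →
               𝟙 (p ×-dec (q ×-dec r)) ≡ 𝟙 p * 𝟙 q * 𝟙 r
    𝟙-×-dec³ p q r = trans (𝟙-×-dec p (q ×-dec r))
      (trans (cong (𝟙 p *_) (𝟙-×-dec q r)) (sym (*-assoc (𝟙 p) (𝟙 q) (𝟙 r))))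

  others-count : ∀ i → ∑[ y < suc N ] 𝟙 (inOthers? A i y) ≡ M * k
  others-count i = begin
    ∑[ y < suc N ] 𝟙 (inOthers? A i y)
      ≡⟨ sum-cong-≗ (λ y → 𝟙-any? (other? y) λ p q → ∈-unique (proj₂ p) (proj₂ q)) ⟩
    ∑[ y < suc N ] (∑[ j < suc M ] 𝟙 (other? y j))
      ≡⟨ ∑-comm (λ y j → 𝟙 (other? y j)) ⟩
    ∑[ j < suc M ] (∑[ y < suc N ] 𝟙 (other? y j))
      ≡⟨ ∑-except _ i own-block other-block ⟩
    M * k
      ∎
    where
    open ≡-Reasoning
    other? : ∀ y j → Dec (j ≢ i × y ∈ A j)
    other? y j = ¬? (j ≟ i) ×-dec y ∈? A j
    own-block : ∑[ y < suc N ] 𝟙 (other? y i) ≡ 0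
    own-block with i ≟ i
    ... | yes _   = trans (∑-const (suc N) 0) (*-zeroʳ (suc N))
    ... | no i≢i = ⊥-elim (i≢i refl)
    other-block : ∀ j → j ≢ i → ∑[ y < suc N ] 𝟙 (other? y j) ≡ k
    other-block j j≢i with j ≟ i
    ... | yes j≡i = ⊥-elim (j≢i j≡i)
    ... | no _    = trans (∑-𝟙-∈ (A j)) (size j)

  ∑-diffCount : ∀ i → ∑[ g < suc N ] diffCount G A i g ≡ k * (M * k)
  ∑-diffCount i = begin
    ∑[ g < suc N ] diffCount G A i g
      ≡⟨ sum-cong-≗ (diffCount≡∑ i) ⟩
    ∑[ g < suc N ] (∑[ x < suc N ] (∑[ y < suc N ] (a x * b y * e x y g)))
      ≡⟨ ∑-comm (λ g x → ∑[ y < suc N ] (a x * b y * e x y g)) ⟩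
    ∑[ x < suc N ] (∑[ g < suc N ] (∑[ y < suc N ] (a x * b y * e x y g)))
      ≡⟨ sum-cong-≗ (λ x → ∑-comm (λ g y → a x * b y * e x y g)) ⟩
    ∑[ x < suc N ] (∑[ y < suc N ] (∑[ g < suc N ] (a x * b y * e x y g)))
      ≡⟨ sum-cong-≗ (λ x → sum-cong-≗ λ y → fibre (a x * b y) (x ∙ (y ⁻¹))) ⟩
    ∑[ x < suc N ] (∑[ y < suc N ] (a x * b y))
      ≡⟨ ∑-product a b ⟩
    sum a * sum b
      ≡⟨ cong₂ _*_ (trans (∑-𝟙-∈ (A i)) (size i)) (others-count i) ⟩
    k * (M * k)
      ∎
    where
    open ≡-Reasoning
    a b : Fin (suc N) → ℕ
    a x = 𝟙 (x ∈? A i)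
    b y = 𝟙 (inOthers? A i y)
    e : Fin (suc N) → Fin (suc N) → Fin (suc N) → ℕ
    e x y g = 𝟙 (x ∙ (y ⁻¹) ≟ g)
    fibre : ∀ w c → ∑[ g < suc N ] (w * 𝟙 (c ≟ g)) ≡ w
    fibre w c = trans (sym (*-distribˡ-sum w (λ g → 𝟙 (c ≟ g))))
                      (trans (cong (w *_) (∑-𝟙-≟ c)) (*-identityʳ w))

  counting-identity : N * lam ≡ k * (M * k)
  counting-identity = trans (sym (∑-except (diffCount G A zero) ε (diffCount-ε zero) (external zero)))
                            (∑-diffCount zero)

proposition4p3 : (n : ℕ) → 1 ≤ n → SquareFree (n ∸ 1) →
    (G : FinGroup n) (m k lam : ℕ) (A : Fin m → Subset n) →
    1 ≤ k → IsSEDF G m k lam A →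
    (k ≡ 1) × (lam ≡ 1) × (m ≡ n)
proposition4p3 zero () _ _ _ _ _ _ _ _
proposition4p3 (suc N) _ squareFree G (suc M) k lam A 1≤k sedf =
  let k≡1 , lam≡1 , M≡N =
        sedf-parameters 1≤M squareFree 1≤k (counting-identity sedf) (packing-bound sedf)
  in k≡1 , lam≡1 , cong suc M≡N
  where
  1≤M : 1 ≤ M
  1≤M = s≤s⁻¹ (IsSEDF.two≤m sedf)
proposition4p3 (suc N) _ _ G zero k lam A _ sedf = case IsSEDF.two≤m sedf of λ ()
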